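{- Let $d\ge1$, let $\mathbf{n}$ be a $d$-tuple of positive integers, let $\mathbf{x}\in\Pi_{\mathbf{n}}$ and let $k\ge0$ be an integer. Then the coefficient $[t^k]\,A_{\mathbf{x}-\mathbf{1}}(t)A_{\mathbf{n}-\mathbf{x}}(t)$ equals the number of maximal chains $F$ of $\Pi_{\mathbf n}$ (facets of the order complex $\Delta_{\mathbf n}$) with $\mathbf{x}\in F$ such that $\#\big(\mathrm{R}(F)\setminus\{\mathbf{x}\}\big)=k$.
   Context: $\Pi_{\mathbf{n}}=[n_1]\times\cdots\times[n_d]$ with the product order ($\mathbf a\le\mathbf b$ iff $a_i\le b_i$ for all $i$); $\mathbf 1=(1,\ldots,1)$ and subtraction is componentwise. Label each cover relation $\mathbf a\lessdot\mathbf b$ of $\Pi_{\mathbf n}$ by $\lambda(\mathbf a,\mathbf b)=i$ where $\mathbf b=\mathbf a+\mathbf e_i$. For a maximal chain $F$, $\mathrm{R}(F)$ is its restriction in the shelling of $\Delta_{\mathbf n}$ given by the lexicographic order of label sequences; equivalently, $\mathrm{R}(F)$ is the set of elements $\mathbf b\in F$ such that $F$ contains $\mathbf a\lessdot\mathbf b\lessdot\mathbf c$ with $\lambda(\mathbf a,\mathbf b)>\lambda(\mathbf b,\mathbf c)$. For a tuple $\mathbf p$ of nonnegative integers, $A_{\mathbf p}(t)=\sum_{\pi\in\mathfrak S_{\mathbf p}}t^{\mathrm{des}(\pi)}$ is the multiset Eulerian polynomial, where $\mathfrak S_{\mathbf p}$ is the set of words in which each letter $i\in[d]$ appears exactly $p_i$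 times and $\mathrm{des}(\pi)$ is the number of indices $i$ with $\pi_i>\pi_{i+1}$. $[t^k]$ denotes the coefficient of $t^k$. -}

module Defs where

open import Data.Nat using (ℕ; zero; suc; _+_; _*_; _∸_; _≡ᵇ_; _<ᵇ_)
open import Data.Bool using (Bool; true; false; _∧_; _∨_; not; if_then_else_; T)
open import Data.Fin using (Fin; toℕ)
open import Data.List using (List; []; _∷_; length; filter; map; concatMap; allFin; upTo)
open import Data.Nat.ListAction using (sum)
open import Data.Vec using (Vec; []; _∷_; replicate)
open import Data.Product using (Σ; _,_)
open import Relation.Nullary.Decidable using (Dec; yes; no)

allWords : (d L : ℕ) → List (List (Fin d))
allWords d zero    = [] ∷ []
allWords d (suc L) = concatMap (λ i → map (i ∷_) (allWords d L)) (allFin d)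

occ : ∀ {d} → Fin d → List (Fin d) → ℕ
occ i []      = 0
occ i (j ∷ w) = (if toℕ i ≡ᵇ toℕ j then 1 else 0) + occ i w

allV : ∀ {d} → (Fin d → Bool) → Bool
allV {d} f = Data.List.foldr (λ i b → f i ∧ b) true (allFin d)

vlookup : ∀ {d} → Vec ℕ d → Fin d → ℕ
vlookup v i = Data.Vec.lookup v i

isMultPerm : ∀ {d} → Vec ℕ d → List (Fin d) → Bool
isMultPerm p w = allV (λ i → occ i w ≡ᵇ vlookup p i)

des : ∀ {d} → List (Fin d) → ℕ
des []            = 0
des (a ∷ [])      = 0
des (a ∷ b ∷ w)   = (if toℕ b <ᵇ toℕ a then 1 else 0) + des (b ∷ w)

vsum : ∀ {d} → Vec ℕ d → ℕ
vsum []      = 0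
vsum (x ∷ v) = x + vsum v

coeffA : ∀ {d} → Vec ℕ d → ℕ → ℕ
coeffA {d} p i =
  length (filter (λ w → T? (isMultPerm p w ∧ (des w ≡ᵇ i))) (allWords d (vsum p)))
  where
  T? : (b : Bool) → Dec (T b)
  T? true  = yes _
  T? false = no (λ ())

coeffProd : ∀ {d} → Vec ℕ d → Vec ℕ d → ℕ → ℕ
coeffProd p q k = sum (map (λ i → coeffA p i * coeffA q (k ∸ i)) (upTo (suc k)))

_==v_ : ∀ {d} → Vec ℕ d → Vec ℕ d → Bool
[] ==v [] = true
(a ∷ as) ==v (b ∷ bs) = (a ≡ᵇ b) ∧ (as ==v bs)

covers : ∀ {d} → Vec ℕ d → Vec ℕ d → Bool
covers [] [] = false
covers (a ∷ as) (b ∷ bs) = ((b ≡ᵇ suc a) ∧ (as ==v bs)) ∨ ((a ≡ᵇ b) ∧ covers as bs)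

-- λ(a,b) = i where b = a + e_i (coordinates numbered from 0; order-preserving shift)
label : ∀ {d} → Vec ℕ d → Vec ℕ d → ℕ
label [] [] = 0
label (a ∷ as) (b ∷ bs) = if a ≡ᵇ b then suc (label as bs) else 0

isPath : ∀ {d} → Vec ℕ d → List (Vec ℕ d) → Vec ℕ d → Bool
isPath a []       t = a ==v t
isPath a (b ∷ bs) t = covers a b ∧ isPath b bs t

isMaxChain : ∀ {d} → Vec ℕ d → List (Vec ℕ d) → Bool
isMaxChain n []       = false
isMaxChain n (a ∷ as) = (a ==v replicate _ 1) ∧ isPath a as n

MaxChain : ∀ {d} → Vec ℕ d → Set
MaxChain {d} n = Σ (List (Vec ℕ d)) (λ c → T (isMaxChain n c))

memV : ∀ {d} → Vec ℕ d → List (Vec ℕ d) → Bool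
memV x []       = false
memV x (a ∷ as) = (x ==v a) ∨ memV x as

-- # (R(F) ∖ {x}) : elements b of F with a ⋖ b ⋖ c in F, λ(a,b) > λ(b,c), b ≠ x
rCountMinus : ∀ {d} → Vec ℕ d → List (Vec ℕ d) → ℕ
rCountMinus x (a ∷ b ∷ c ∷ rest) =
  (if (label b c <ᵇ label a b) ∧ not (b ==v x) then 1 else 0) + rCountMinus x (b ∷ c ∷ rest)
rCountMinus x _ = 0

-- A maximal chain of Π_n is a lattice walk 𝟏 = c₀ ⋖ c₁ ⋖ ⋯ ⋖ n, determined by its word of step
-- directions, and λ(c_{j-1}, c_j) is the j-th letter of that word; so R(F) consists of the vertices
-- sitting at the descents of the word. The walk passes through x exactly when its word splits as uv
-- with u ∈ 𝔖_{x-1} and v ∈ 𝔖_{n-x}, and the split is unique because the rank Σᵢ cᵢ increases along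
-- the walk. Removing x from R(F) discards precisely the descent at the junction of u and v, so
-- #(R(F) ∖ {x}) = des u + des v, and the pairs (u, v) with des u + des v = k are what the
-- coefficient [t^k] A_{x-1}(t) A_{n-x}(t) counts.

module Submission where

open import Defs
open import Data.Nat using (ℕ; _≤_; _∸_; pred; _≡ᵇ_)
open import Data.Bool using (T; _∧_)
open import Data.Fin using (Fin)
open import Data.Vec using (Vec; lookup; map; zipWith)
open import Data.Product using (Σ; _×_; proj₁)
open import Function.Bundles using (_↔_)

open import Axiom.UniquenessOfIdentityProofs using (module Decidable⇒UIP)
open import Data.Bool using (Bool; true; false; not; if_then_else_)
open import Data.Bool.Properties using (T-∧; T-∨; T-irrelevant; ∧-identityʳ; ∧-zeroʳ)
open import Data.Empty using (⊥-elim)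
open import Data.Fin using (zero; suc; toℕ; fromℕ<)
open import Data.Fin.Properties using (+↔⊎; *↔×; 0↔⊥; 1↔⊤; toℕ<n; toℕ-fromℕ<; toℕ-injective)
open import Data.List using (List; []; _∷_; _++_; length; filter; foldl; foldr; tabulate; applyUpTo; upTo)
import Data.List as List
open import Data.List.Properties using (foldl-++; ∷-injectiveˡ; ∷-injectiveʳ)
open import Data.List.Relation.Unary.Any using (Any; here; there)
open import Data.List.Relation.Unary.Any.Properties using (Any-cong; concat↔; map↔; ⊥↔Any[]; ∷↔)
open import Data.Nat using (zero; suc; _+_; _<ᵇ_; s≤s; s≤s⁻¹; >-nonZero)
open import Data.Nat.ListAction using (sum)
open import Data.Nat.Properties
open import Data.Product using (_,_; proj₂)
open import Data.Product.Function.NonDependent.Propositional using (_×-cong_)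
open import Data.Sum using (inj₁; inj₂)
open import Data.Sum.Function.Propositional using (_⊎-cong_)
open import Data.Vec using ([]; _∷_; replicate)
import Data.Vec as Vec
open import Data.Vec.Properties
  using (≡-dec; lookup-map; lookup-replicate; lookup-zipWith; tabulate∘lookup; tabulate-cong; zipWith-identityˡ)
open import Function using (_∘_)
open import Function.Bundles using (_⇔_; mk⇔; mk↔ₛ′; Equivalence)
open import Function.Properties.Inverse using (↔-refl; ↔-sym; ↔-trans)
open import Function.Related.TypeIsomorphisms using (Σ-assoc)
open import Relation.Binary.PropositionalEquality
open import Relation.Nullary using (contradiction; yes; no)
open import Relation.Nullary.Irrelevant using (Irrelevant)
open import Relation.Nullary.Reflects using (Reflects; ofʸ; ofⁿ; fromEquivalence; det)
open import Relation.Unary using (Decidable)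

private variable
  d : ℕ
  A B : Set
  P : A → Set
  Q : B → Set

-- Bijections between subtypes, and counting in lists

×-irrelevant : Irrelevant A → Irrelevant B → Irrelevant (A × B)
×-irrelevant irrA irrB (a , b) (a′ , b′) = cong₂ _,_ (irrA a a′) (irrB b b′)

Σ-≡-irrelevant : (∀ i → Irrelevant (P i)) →
  ∀ {i i′} {p : P i} {p′ : P i′} → i ≡ i′ → (i , p) ≡ (i′ , p′)
Σ-≡-irrelevant irr {i} refl = cong (i ,_) (irr i _ _)

subtype-↔ : (f : A → B) → (∀ i → Irrelevant (P i)) → (∀ j → Irrelevant (Q j))
  → (∀ i → P i → Q (f i))
  → (∀ i i′ → P i → P i′ → f i ≡ f i′ → i ≡ i′)
  → (∀ j → Q j → Σ A λ i → P i × f i ≡ j)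
  → Σ A P ↔ Σ B Q
subtype-↔ {P = P} {Q = Q} f irrP irrQ into injective onto = mk↔ₛ′ to from to∘from from∘to
  where
  to : Σ _ P → Σ _ Q
  to (i , p) = f i , into i p
  from : Σ _ Q → Σ _ P
  from (j , q) = let i , p , _ = onto j q in i , p
  to∘from : ∀ y → to (from y) ≡ y
  to∘from (j , q) = Σ-≡-irrelevant irrQ (proj₂ (proj₂ (onto j q)))
  from∘to : ∀ y → from (to y) ≡ y
  from∘to (i , p) =
    let i′ , p′ , fi′≡fi = onto (f i) (into i p) in Σ-≡-irrelevant irrP (injective i′ i p′ p fi′≡fi)

Σ-cong-irrelevant : (∀ i → Irrelevant (P i)) → (∀ i → Irrelevant (Q i))
  → (∀ i → P i → Q i) → (∀ i → Q i → P i) → Σ A P ↔ Σ A Q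
Σ-cong-irrelevant irrP irrQ to from =
  subtype-↔ (λ i → i) irrP irrQ to (λ _ _ _ _ e → e) (λ i q → i , from i q , refl)

irrelevant-↔ : Irrelevant A → Irrelevant B → (A → B) → (B → A) → A ↔ B
irrelevant-↔ irrA irrB to from = mk↔ₛ′ to from (λ _ → irrB _ _) (λ _ → irrA _ _)

Fin-length-filter↔Any : (P? : Decidable P) → (∀ {x} → Irrelevant (P x)) →
  ∀ xs → Fin (length (filter P? xs)) ↔ Any P xs
Fin-length-filter↔Any P? irr []       = ↔-trans 0↔⊥ ⊥↔Any[]
Fin-length-filter↔Any {P = P} P? irr (x ∷ xs) with P? x
... | yes px = ↔-trans (+↔⊎ {1}) (↔-trans (Fin1↔P ⊎-cong Fin-length-filter↔Any P? irr xs) (∷↔ P))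
  where Fin1↔P : Fin 1 ↔ P x
        Fin1↔P = ↔-trans 1↔⊤ (irrelevant-↔ (λ _ _ → refl) irr (λ _ → px) _)
... | no ¬px = ↔-trans (+↔⊎ {0}) (↔-trans (Fin0↔P ⊎-cong Fin-length-filter↔Any P? irr xs) (∷↔ P))
  where Fin0↔P : Fin 0 ↔ P x
        Fin0↔P = irrelevant-↔ (λ ()) irr (λ ()) (⊥-elim ∘ ¬px)

Fin-sum↔Any : (f : A → ℕ) → ∀ xs → Fin (sum (List.map f xs)) ↔ Any (Fin ∘ f) xs
Fin-sum↔Any f []       = ↔-trans 0↔⊥ ⊥↔Any[]
Fin-sum↔Any f (x ∷ xs) = ↔-trans +↔⊎ (↔-trans (↔-refl ⊎-cong Fin-sum↔Any f xs) (∷↔ _))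

Any-tabulate↔ : ∀ {n} (g : Fin n → A) → Any P (tabulate g) ↔ Σ (Fin n) (P ∘ g)
Any-tabulate↔ {P = P} g = mk↔ₛ′ (to g) (from g) (to∘from g) (from∘to g)
  where
  to : ∀ {n} (g : Fin n → _) → Any P (tabulate g) → Σ (Fin n) (P ∘ g)
  to {suc _} g (here p)  = zero , p
  to {suc _} g (there a) = let i , p = to (g ∘ suc) a in suc i , p
  from : ∀ {n} (g : Fin n → _) → Σ (Fin n) (P ∘ g) → Any P (tabulate g)
  from g (zero  , p) = here p
  from g (suc i , p) = there (from (g ∘ suc) (i , p))
  to∘from : ∀ {n} (g : Fin n → _) y → to g (from g y) ≡ y
  to∘from g (zero  , p) = refl
  to∘from g (suc i , p) = cong (λ (i , p) → suc i , p) (to∘from (g ∘ suc) (i , p))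
  from∘to : ∀ {n} (g : Fin n → _) y → from g (to g y) ≡ y
  from∘to {suc _} g (here p)  = refl
  from∘to {suc _} g (there a) = cong there (from∘to (g ∘ suc) a)

Σ-∷↔ : ∀ {d L} (P : List (Fin d) → Set) →
  Σ (Fin d) (λ i → Σ (List (Fin d)) λ w → length w ≡ L × P (i ∷ w))
  ↔ Σ (List (Fin d)) λ w → length w ≡ suc L × P w
Σ-∷↔ P = mk↔ₛ′ to from to∘from from∘to
  where
  to : Σ _ (λ i → Σ _ λ w → length w ≡ _ × P (i ∷ w)) → Σ _ λ w → length w ≡ _ × P w
  to (i , w , len , p) = i ∷ w , cong suc len , p
  from : Σ _ (λ w → length w ≡ suc _ × P w) → Σ _ λ i → Σ _ λ w → length w ≡ _ × P (i ∷ w)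
  from (i ∷ w , len , p) = i , w , suc-injective len , p
  to∘from : ∀ y → to (from y) ≡ y
  to∘from (i ∷ w , len , p) = cong (λ len → i ∷ w , len , p) (≡-irrelevant _ _)
  from∘to : ∀ y → from (to y) ≡ y
  from∘to (i , w , len , p) = cong (λ len → i , w , len , p) (≡-irrelevant _ _)

Any-allWords↔ : ∀ d L (P : List (Fin d) → Set) →
  Any P (allWords d L) ↔ Σ (List (Fin d)) λ w → length w ≡ L × P w
Any-allWords↔ d zero    P = mk↔ₛ′ (λ { (here p) → [] , refl , p }) (λ { ([] , refl , p) → here p })
                                   (λ { ([] , refl , p) → refl }) (λ { (here p) → refl })
Any-allWords↔ d (suc L) P =
  ↔-trans (↔-sym concat↔) (↔-trans (↔-sym map↔) (↔-trans
    (Any-cong (λ i → ↔-trans (↔-sym map↔) (Any-allWords↔ d L (P ∘ (i ∷_)))) ↔-refl)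
    (↔-trans (Any-tabulate↔ (λ i → i)) (Σ-∷↔ P))))

applyUpTo≡tabulate : ∀ (f : ℕ → A) n → applyUpTo f n ≡ tabulate {n = n} (f ∘ toℕ)
applyUpTo≡tabulate f zero    = refl
applyUpTo≡tabulate f (suc n) = cong (f 0 ∷_) (applyUpTo≡tabulate (f ∘ suc) n)

Any-upTo↔ : ∀ {P : ℕ → Set} n → Any P (upTo n) ↔ Σ (Fin n) (P ∘ toℕ)
Any-upTo↔ {P = P} n =
  subst (λ xs → Any P xs ↔ Σ (Fin n) (P ∘ toℕ)) (sym (applyUpTo≡tabulate (λ i → i) n))
        (Any-tabulate↔ toℕ)

antidiagonal↔ : ∀ {X Y : Set} (P : X → Set) (Q : Y → Set) (f : X → ℕ) (g : Y → ℕ) k →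
  Σ (Fin (suc k)) (λ j → (Σ X λ u → P u × f u ≡ toℕ j) × (Σ Y λ v → Q v × g v ≡ k ∸ toℕ j))
  ↔ Σ (X × Y) λ (u , v) → (P u × Q v) × f u + g v ≡ k
antidiagonal↔ {X} {Y} P Q f g k = mk↔ₛ′ to from to∘from from∘to
  where
  Split : ℕ → Set
  Split i = (Σ X λ u → P u × f u ≡ i) × (Σ Y λ v → Q v × g v ≡ k ∸ i)
  Sum : Set
  Sum = Σ (X × Y) λ (u , v) → (P u × Q v) × f u + g v ≡ k
  to : Σ (Fin (suc k)) (Split ∘ toℕ) → Sum
  to (j , (u , a , fu) , (v , b , gv)) =
    (u , v) , (a , b) , trans (cong₂ _+_ fu gv) (m+[n∸m]≡n (s≤s⁻¹ (toℕ<n j)))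
  index : ∀ u v → f u + g v ≡ k → Fin (suc k)
  index u v e = fromℕ< (s≤s (subst (f u ≤_) e (m≤m+n (f u) (g v))))
  from : Sum → Σ (Fin (suc k)) (Split ∘ toℕ)
  from ((u , v) , (a , b) , e) = index u v e , (u , a , sym fu≡j) , (v , b , gv≡k∸j)
    where
    fu≡j : toℕ (index u v e) ≡ f u
    fu≡j = toℕ-fromℕ< _
    gv≡k∸j : g v ≡ k ∸ toℕ (index u v e)
    gv≡k∸j = trans (sym (m+n∸m≡n (f u) (g v))) (cong₂ _∸_ e (sym fu≡j))
  to∘from : ∀ y → to (from y) ≡ y
  to∘from (uv , ab , e) = cong (λ e → uv , ab , e) (≡-irrelevant _ _)
  reindex : ∀ {j j′ : Fin (suc k)} → j ≡ j′ → ∀ {u a v b fu fu′ gv gv′} →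
    _≡_ {A = Σ (Fin (suc k)) (Split ∘ toℕ)}
        (j , (u , a , fu) , (v , b , gv)) (j′ , (u , a , fu′) , (v , b , gv′))
  reindex {j} refl {u} {a} {v} {b} =
    cong₂ (λ fu gv → j , (u , a , fu) , (v , b , gv)) (≡-irrelevant _ _) (≡-irrelevant _ _)
  from∘to : ∀ y → from (to y) ≡ y
  from∘to (j , (u , a , fu) , (v , b , gv)) = reindex (toℕ-injective (trans (toℕ-fromℕ< _) fu))

-- Lattice walks in ℕ^d

≡ᵇ-reflects : ∀ m n → Reflects (m ≡ n) (m ≡ᵇ n)
≡ᵇ-reflects m n = fromEquivalence (≡ᵇ⇒≡ m n) (≡⇒≡ᵇ m n)

==v⇒≡ : ∀ (a b : Vec ℕ d) → T (a ==v b) → a ≡ b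
==v⇒≡ [] [] _ = refl
==v⇒≡ (m ∷ a) (n ∷ b) p =
  cong₂ _∷_ (≡ᵇ⇒≡ m n (proj₁ (Equivalence.to T-∧ p))) (==v⇒≡ a b (proj₂ (Equivalence.to T-∧ p)))

≡⇒==v : ∀ (a b : Vec ℕ d) → a ≡ b → T (a ==v b)
≡⇒==v [] [] _ = _
≡⇒==v (m ∷ a) (.m ∷ .a) refl = Equivalence.from T-∧ (≡⇒≡ᵇ m m refl , ≡⇒==v a a refl)

==v-reflects : ∀ (a b : Vec ℕ d) → Reflects (a ≡ b) (a ==v b)
==v-reflects a b = fromEquivalence (==v⇒≡ a b) (≡⇒==v a b)

step : Vec ℕ d → Fin d → Vec ℕ d
step (m ∷ a) zero    = suc m ∷ a
step (m ∷ a) (suc i) = m ∷ step a i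

walkEnd : Vec ℕ d → List (Fin d) → Vec ℕ d
walkEnd = foldl step

walk : Vec ℕ d → List (Fin d) → List (Vec ℕ d)
walk a []      = []
walk a (i ∷ w) = step a i ∷ walk (step a i) w

covers-step : ∀ (a : Vec ℕ d) i → T (covers a (step a i))
covers-step (m ∷ a) zero    = Equivalence.from T-∨ (inj₁ (≡⇒==v (suc m ∷ a) (suc m ∷ a) refl))
covers-step (m ∷ a) (suc i) =
  Equivalence.from T-∨ (inj₂ (Equivalence.from T-∧ (≡⇒≡ᵇ m m refl , covers-step a i)))

covers⇒step : ∀ (a b : Vec ℕ d) → T (covers a b) → Σ (Fin d) λ i → b ≡ step a i
covers⇒step [] [] ()
covers⇒step (m ∷ a) (n ∷ b) p with Equivalence.to T-∨ p
... | inj₁ q = let n≡1+m , b=a = Equivalence.to T-∧ q in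
  zero , cong₂ _∷_ (≡ᵇ⇒≡ n (suc m) n≡1+m) (sym (==v⇒≡ a b b=a))
... | inj₂ q with covers⇒step a b (proj₂ (Equivalence.to T-∧ q))
...   | i , b≡ = suc i , cong₂ _∷_ (sym (≡ᵇ⇒≡ m n (proj₁ (Equivalence.to T-∧ q)))) b≡

step-injective : ∀ (a : Vec ℕ d) {i j} → step a i ≡ step a j → i ≡ j
step-injective (m ∷ a) {zero}  {zero}  e = refl
step-injective (m ∷ a) {zero}  {suc j} e = contradiction (cong Vec.head e) 1+n≢n
step-injective (m ∷ a) {suc i} {zero}  e = contradiction (cong Vec.head (sym e)) 1+n≢n
step-injective (m ∷ a) {suc i} {suc j} e = cong suc (step-injective a (cong Vec.tail e))

label-step : ∀ (a : Vec ℕ d) i → label a (step a i) ≡ toℕ i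
label-step (m ∷ a) zero    rewrite det (≡ᵇ-reflects m (suc m)) (ofⁿ (1+n≢n ∘ sym)) = refl
label-step (m ∷ a) (suc i) rewrite det (≡ᵇ-reflects m m) (ofʸ refl) = cong suc (label-step a i)

vsum-step : ∀ (a : Vec ℕ d) i → vsum (step a i) ≡ suc (vsum a)
vsum-step (m ∷ a) zero    = refl
vsum-step (m ∷ a) (suc i) = trans (cong (m +_) (vsum-step a i)) (+-suc m (vsum a))

vsum-walkEnd : ∀ (a : Vec ℕ d) w → vsum (walkEnd a w) ≡ vsum a + length w
vsum-walkEnd a []      = sym (+-identityʳ (vsum a))
vsum-walkEnd a (i ∷ w) = begin
  vsum (walkEnd (step a i) w)   ≡⟨ vsum-walkEnd (step a i) w ⟩
  vsum (step a i) + length w    ≡⟨ cong (_+ length w) (vsum-step a i) ⟩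
  suc (vsum a) + length w       ≡⟨ +-suc (vsum a) (length w) ⟨
  vsum a + length (i ∷ w)       ∎
  where open ≡-Reasoning

lookup-step : ∀ (a : Vec ℕ d) j i → lookup (step a j) i ≡ lookup a i + (if toℕ i ≡ᵇ toℕ j then 1 else 0)
lookup-step (m ∷ a) zero    zero    = +-comm 1 m
lookup-step (m ∷ a) zero    (suc i) = sym (+-identityʳ _)
lookup-step (m ∷ a) (suc j) zero    = sym (+-identityʳ m)
lookup-step (m ∷ a) (suc j) (suc i) = lookup-step a j i

lookup-walkEnd : ∀ (a : Vec ℕ d) w i → lookup (walkEnd a w) i ≡ lookup a i + occ i w
lookup-walkEnd a []      i = sym (+-identityʳ _)
lookup-walkEnd a (j ∷ w) i = begin
  lookup (walkEnd (step a j) w) i       ≡⟨ lookup-walkEnd (step a j) w i ⟩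
  lookup (step a j) i + occ i w         ≡⟨ cong (_+ occ i w) (lookup-step a j i) ⟩
  lookup a i + _ + occ i w              ≡⟨ +-assoc (lookup a i) _ (occ i w) ⟩
  lookup a i + occ i (j ∷ w)            ∎
  where open ≡-Reasoning

walk-isPath : ∀ (a t : Vec ℕ d) w → walkEnd a w ≡ t → T (isPath a (walk a w) t)
walk-isPath a t []      a≡t = ≡⇒==v a t a≡t
walk-isPath a t (i ∷ w) e   = Equivalence.from T-∧ (covers-step a i , walk-isPath (step a i) t w e)

isPath⇒walk : ∀ (a t : Vec ℕ d) cs → T (isPath a cs t) →
  Σ (List (Fin d)) λ w → walk a w ≡ cs × walkEnd a w ≡ t
isPath⇒walk a t []       p = [] , refl , ==v⇒≡ a t p
isPath⇒walk a t (b ∷ cs) p with covers⇒step a b (proj₁ (Equivalence.to T-∧ p))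
... | i , refl with isPath⇒walk (step a i) t cs (proj₂ (Equivalence.to T-∧ p))
...   | w , refl , e = i ∷ w , refl , e

walk-injective : ∀ (a : Vec ℕ d) w w′ → walk a w ≡ walk a w′ → w ≡ w′
walk-injective a []      []       _ = refl
walk-injective a (i ∷ w) (j ∷ w′) e with step-injective a (∷-injectiveˡ e)
... | refl = cong (i ∷_) (walk-injective (step a i) w w′ (∷-injectiveʳ e))

-- R(F) ∖ {x} along a walk

rCountMinus-step : ∀ (x a : Vec ℕ d) i j cs →
  rCountMinus x (a ∷ step a i ∷ step (step a i) j ∷ cs)
    ≡ (if (toℕ j <ᵇ toℕ i) ∧ not (step a i ==v x) then 1 else 0)
      + rCountMinus x (step a i ∷ step (step a i) j ∷ cs)
rCountMinus-step x a i j cs rewrite label-step a i | label-step (step a i) j = refl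

vsum≢⇒==v-false : ∀ (a b : Vec ℕ d) → vsum a ≢ vsum b → (a ==v b) ≡ false
vsum≢⇒==v-false a b ne = det (==v-reflects a b) (ofⁿ (ne ∘ cong vsum))

vsum-step≢ : ∀ (x a : Vec ℕ d) i → vsum x ≤ vsum a → vsum (step a i) ≢ vsum x
vsum-step≢ x a i x≤a e = 1+n≰n (≤-trans (≤-reflexive (trans (sym (vsum-step a i)) e)) x≤a)

descent-unmasked : ∀ b {c} → c ≡ false → (if b ∧ not c then 1 else 0) ≡ (if b then 1 else 0)
descent-unmasked b refl = cong (λ b → if b then 1 else 0) (∧-identityʳ b)

descent-masked : ∀ b {c} → c ≡ true → (if b ∧ not c then 1 else 0) ≡ 0
descent-masked b refl = cong (λ b → if b then 1 else 0) (∧-zeroʳ b)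

rCountMinus-beyond : ∀ (x a : Vec ℕ d) w → vsum x ≤ vsum a → rCountMinus x (a ∷ walk a w) ≡ des w
rCountMinus-beyond x a []          _ = refl
rCountMinus-beyond x a (i ∷ [])    _ = refl
rCountMinus-beyond x a (i ∷ j ∷ w) x≤a =
  trans (rCountMinus-step x a i j (walk (step (step a i) j) w)) (cong₂ _+_
    (descent-unmasked (toℕ j <ᵇ toℕ i) (vsum≢⇒==v-false (step a i) x (vsum-step≢ x a i x≤a)))
    (rCountMinus-beyond x (step a i) (j ∷ w) (subst (vsum x ≤_) (sym (vsum-step a i)) (m≤n⇒m≤1+n x≤a))))

vsum≢vsum-walkEnd-∷ : ∀ (a : Vec ℕ d) i w → vsum a ≢ vsum (walkEnd a (i ∷ w))
vsum≢vsum-walkEnd-∷ a i w e = m+1+n≢m (vsum a) (sym (trans e (vsum-walkEnd a (i ∷ w))))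

rCountMinus-through : ∀ (x a : Vec ℕ d) u v → walkEnd a u ≡ x →
  rCountMinus x (a ∷ walk a (u ++ v)) ≡ des u + des v
rCountMinus-through x a []           v       a≡x = rCountMinus-beyond x a v (≤-reflexive (cong vsum (sym a≡x)))
rCountMinus-through x a (i ∷ [])     []      _   = refl
rCountMinus-through x a (i ∷ [])     (j ∷ v) s≡x =
  trans (rCountMinus-step x a i j (walk (step (step a i) j) v)) (cong₂ _+_
    (descent-masked (toℕ j <ᵇ toℕ i) (det (==v-reflects (step a i) x) (ofʸ s≡x)))
    (rCountMinus-beyond x (step a i) (j ∷ v) (≤-reflexive (cong vsum (sym s≡x)))))
rCountMinus-through x a (i ∷ i′ ∷ u) v e = begin
  rCountMinus x (a ∷ walk a (i ∷ i′ ∷ u ++ v))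
    ≡⟨ rCountMinus-step x a i i′ (walk (step (step a i) i′) (u ++ v)) ⟩
  (if (toℕ i′ <ᵇ toℕ i) ∧ not (step a i ==v x) then 1 else 0)
    + rCountMinus x (step a i ∷ walk (step a i) (i′ ∷ u ++ v))
    ≡⟨ cong₂ _+_ (descent-unmasked (toℕ i′ <ᵇ toℕ i) step≠x)
                 (rCountMinus-through x (step a i) (i′ ∷ u) v e) ⟩
  (if toℕ i′ <ᵇ toℕ i then 1 else 0) + (des (i′ ∷ u) + des v)
    ≡⟨ +-assoc _ (des (i′ ∷ u)) (des v) ⟨
  des (i ∷ i′ ∷ u) + des v
    ∎
  where
  open ≡-Reasoning
  step≠x : (step a i ==v x) ≡ false
  step≠x = vsum≢⇒==v-false (step a i) x
    (subst (λ y → vsum (step a i) ≢ vsum y) e (vsum≢vsum-walkEnd-∷ (step a i) i′ u))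

split⇒memV-walk : ∀ (x a : Vec ℕ d) u v → walkEnd a u ≡ x → T (memV x (a ∷ walk a (u ++ v)))
split⇒memV-walk x a []      v a≡x = Equivalence.from T-∨ (inj₁ (≡⇒==v x a (sym a≡x)))
split⇒memV-walk x a (i ∷ u) v e   =
  Equivalence.from (T-∨ {x ==v a}) (inj₂ (split⇒memV-walk x (step a i) u v e))

memV-walk⇒split : ∀ (x a : Vec ℕ d) w → T (memV x (a ∷ walk a w)) →
  Σ (List (Fin d) × List (Fin d)) λ (u , v) → u ++ v ≡ w × walkEnd a u ≡ x
memV-walk⇒split x a w p with Equivalence.to T-∨ p
memV-walk⇒split x a w       p | inj₁ x=a = ([] , w) , refl , sym (==v⇒≡ x a x=a)
memV-walk⇒split x a []      p | inj₂ ()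
memV-walk⇒split x a (i ∷ w) p | inj₂ q with memV-walk⇒split x (step a i) w q
... | (u , v) , refl , e = (i ∷ u , v) , refl , e

++-injective : ∀ (u u′ : List A) {v v′} →
  length u ≡ length u′ → u ++ v ≡ u′ ++ v′ → u ≡ u′ × v ≡ v′
++-injective []      []       _ e = refl , e
++-injective (x ∷ u) (x′ ∷ u′) l e with ++-injective u u′ (suc-injective l) (∷-injectiveʳ e)
... | refl , v≡v′ = cong (_∷ u) (∷-injectiveˡ e) , v≡v′

walk-split-unique : ∀ (a : Vec ℕ d) u u′ {v v′} →
  walkEnd a u ≡ walkEnd a u′ → u ++ v ≡ u′ ++ v′ → u ≡ u′ × v ≡ v′
walk-split-unique a u u′ ends e = ++-injective u u′
  (+-cancelˡ-≡ (vsum a) _ _ (trans (sym (vsum-walkEnd a u)) (trans (cong vsum ends) (vsum-walkEnd a u′)))) e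

-- Multiset permutations, Eulerian coefficients and maximal chains

T-foldr-∧-tabulate : ∀ {n} (f : A → Bool) (g : Fin n → A) →
  T (foldr (λ i b → f i ∧ b) true (tabulate g)) ⇔ (∀ j → T (f (g j)))
T-foldr-∧-tabulate {n = zero}  f g = mk⇔ (λ _ ()) (λ _ → _)
T-foldr-∧-tabulate {n = suc n} f g = mk⇔
  (λ p → let at0 , atSuc = Equivalence.to T-∧ p in
     λ { zero → at0 ; (suc j) → Equivalence.to rest atSuc j })
  (λ h → Equivalence.from T-∧ (h zero , Equivalence.from rest (h ∘ suc)))
  where
  rest : T (foldr (λ i b → f i ∧ b) true (tabulate (g ∘ suc))) ⇔ (∀ j → T (f (g (suc j))))
  rest = T-foldr-∧-tabulate f (g ∘ suc)

isMultPerm⇔occ : ∀ (p : Vec ℕ d) w → T (isMultPerm p w) ⇔ (∀ i → occ i w ≡ lookup p i)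
isMultPerm⇔occ p w = mk⇔
  (λ h i → ≡ᵇ⇒≡ _ _ (Equivalence.to allLetters h i))
  (λ h → Equivalence.from allLetters (λ i → ≡⇒≡ᵇ _ _ (h i)))
  where
  allLetters : T (isMultPerm p w) ⇔ (∀ i → T (occ i w ≡ᵇ lookup p i))
  allLetters = T-foldr-∧-tabulate (λ i → occ i w ≡ᵇ lookup p i) (λ i → i)

Vec-ext : ∀ {xs ys : Vec A d} → (∀ i → lookup xs i ≡ lookup ys i) → xs ≡ ys
Vec-ext {xs = xs} {ys} h = trans (sym (tabulate∘lookup xs)) (trans (tabulate-cong h) (tabulate∘lookup ys))

isMultPerm⇔walkEnd : ∀ (p a : Vec ℕ d) w → T (isMultPerm p w) ⇔ walkEnd a w ≡ zipWith _+_ a p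
isMultPerm⇔walkEnd p a w = mk⇔
  (λ h → Vec-ext λ i → begin
     lookup (walkEnd a w) i        ≡⟨ lookup-walkEnd a w i ⟩
     lookup a i + occ i w          ≡⟨ cong (lookup a i +_) (Equivalence.to (isMultPerm⇔occ p w) h i) ⟩
     lookup a i + lookup p i       ≡⟨ lookup-zipWith _+_ i a p ⟨
     lookup (zipWith _+_ a p) i    ∎)
  (λ e → Equivalence.from (isMultPerm⇔occ p w) λ i → +-cancelˡ-≡ (lookup a i) _ _ (begin
     lookup a i + occ i w          ≡⟨ lookup-walkEnd a w i ⟨
     lookup (walkEnd a w) i        ≡⟨ cong (λ b → lookup b i) e ⟩
     lookup (zipWith _+_ a p) i    ≡⟨ lookup-zipWith _+_ i a p ⟩
     lookup a i + lookup p i       ∎))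
  where open ≡-Reasoning

vsum-replicate-0 : ∀ d → vsum (replicate d 0) ≡ 0
vsum-replicate-0 zero    = refl
vsum-replicate-0 (suc d) = vsum-replicate-0 d

isMultPerm⇒length : ∀ (p : Vec ℕ d) w → T (isMultPerm p w) → length w ≡ vsum p
isMultPerm⇒length {d} p w h = begin
  length w                                  ≡⟨ cong (_+ length w) (vsum-replicate-0 d) ⟨
  vsum (replicate d 0) + length w           ≡⟨ vsum-walkEnd (replicate d 0) w ⟨
  vsum (walkEnd (replicate d 0) w)          ≡⟨ cong vsum (Equivalence.to (isMultPerm⇔walkEnd p (replicate d 0) w) h) ⟩
  vsum (zipWith _+_ (replicate d 0) p)      ≡⟨ cong vsum (zipWith-identityˡ +-identityˡ p) ⟩
  vsum p                                    ∎
  where open ≡-Reasoning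

DesWords : Vec ℕ d → ℕ → Set
DesWords {d} p i = Σ (List (Fin d)) λ w → T (isMultPerm p w) × des w ≡ i

Fin-coeffA↔DesWords : ∀ (p : Vec ℕ d) i → Fin (coeffA p i) ↔ DesWords p i
Fin-coeffA↔DesWords {d} p i =
  ↔-trans (Fin-length-filter↔Any _ T-irrelevant (allWords d (vsum p)))
  (↔-trans (Any-allWords↔ d (vsum p) _)
           (Σ-cong-irrelevant (λ _ → ×-irrelevant ≡-irrelevant T-irrelevant)
                              (λ _ → ×-irrelevant T-irrelevant ≡-irrelevant) to from))
  where
  to : ∀ w → length w ≡ vsum p × T (isMultPerm p w ∧ (des w ≡ᵇ i)) → T (isMultPerm p w) × des w ≡ i
  to w (_ , h) = let mp , dᵇ = Equivalence.to (T-∧ {isMultPerm p w}) h in mp , ≡ᵇ⇒≡ (des w) i dᵇ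
  from : ∀ w → T (isMultPerm p w) × des w ≡ i → length w ≡ vsum p × T (isMultPerm p w ∧ (des w ≡ᵇ i))
  from w (mp , e) =
    isMultPerm⇒length p w mp , Equivalence.from (T-∧ {isMultPerm p w}) (mp , ≡⇒≡ᵇ (des w) i e)

Fin-coeffProd↔ : ∀ (p q : Vec ℕ d) k → Fin (coeffProd p q k)
  ↔ Σ (List (Fin d) × List (Fin d)) λ (u , v) → (T (isMultPerm p u) × T (isMultPerm q v)) × des u + des v ≡ k
Fin-coeffProd↔ p q k =
  ↔-trans (Fin-sum↔Any _ (upTo (suc k)))
  (↔-trans (Any-cong (λ i → ↔-trans *↔× (Fin-coeffA↔DesWords p i ×-cong Fin-coeffA↔DesWords q (k ∸ i)))
                     ↔-refl)
  (↔-trans (Any-upTo↔ (suc k))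
           (antidiagonal↔ (T ∘ isMultPerm p) (T ∘ isMultPerm q) des des k)))

Vec-≡-irrelevant : {a b : Vec ℕ d} → Irrelevant (a ≡ b)
Vec-≡-irrelevant = Decidable⇒UIP.≡-irrelevant (≡-dec _≟_)

walks-through↔ : ∀ (a x t : Vec ℕ d) k →
  Σ (List (Fin d) × List (Fin d)) (λ (u , v) → (walkEnd a u ≡ x × walkEnd x v ≡ t) × des u + des v ≡ k)
  ↔ Σ (List (Fin d)) λ w →
      walkEnd a w ≡ t × T (memV x (a ∷ walk a w) ∧ (rCountMinus x (a ∷ walk a w) ≡ᵇ k))
walks-through↔ {d} a x t k = subtype-↔ (λ (u , v) → u ++ v)
  (λ _ → ×-irrelevant (×-irrelevant Vec-≡-irrelevant Vec-≡-irrelevant) ≡-irrelevant)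
  (λ _ → ×-irrelevant Vec-≡-irrelevant T-irrelevant)
  into injective onto
  where
  Words² : Set
  Words² = List (Fin d) × List (Fin d)
  Split : Words² → Set
  Split (u , v) = (walkEnd a u ≡ x × walkEnd x v ≡ t) × des u + des v ≡ k
  Through : List (Fin d) → Set
  Through w = walkEnd a w ≡ t × T (memV x (a ∷ walk a w) ∧ (rCountMinus x (a ∷ walk a w) ≡ᵇ k))
  into : ∀ uv → Split uv → Through (proj₁ uv ++ proj₂ uv)
  into (u , v) ((a→x , x→t) , e) =
    trans (foldl-++ step a u v) (trans (cong (λ b → walkEnd b v) a→x) x→t) ,
    Equivalence.from T-∧
      (split⇒memV-walk x a u v a→x , ≡⇒≡ᵇ _ _ (trans (rCountMinus-through x a u v a→x) e))
  injective : ∀ uv uv′ → Split uv → Split uv′ →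
    proj₁ uv ++ proj₂ uv ≡ proj₁ uv′ ++ proj₂ uv′ → uv ≡ uv′
  injective (u , v) (u′ , v′) ((a→x , _) , _) ((a→x′ , _) , _) e
    with walk-split-unique a u u′ (trans a→x (sym a→x′)) e
  ... | refl , refl = refl
  onto : ∀ w → Through w → Σ Words² λ uv → Split uv × proj₁ uv ++ proj₂ uv ≡ w
  onto w (a→t , h) with Equivalence.to (T-∧ {memV x (a ∷ walk a w)}) h
  ... | mem , r with memV-walk⇒split x a w mem
  ...   | (u , v) , refl , a→x =
    (u , v) , ((a→x , x→t) , trans (sym (rCountMinus-through x a u v a→x)) (≡ᵇ⇒≡ _ _ r)) , refl
    where
    x→t : walkEnd x v ≡ t
    x→t = trans (cong (λ b → walkEnd b v) (sym a→x)) (trans (sym (foldl-++ step a u v)) a→t)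

maxChains↔ : ∀ (n : Vec ℕ d) (Q : List (Vec ℕ d) → Set) → (∀ c → Irrelevant (Q c)) →
  Σ (List (Fin d)) (λ w → walkEnd (replicate d 1) w ≡ n × Q (replicate d 1 ∷ walk (replicate d 1) w))
  ↔ Σ (MaxChain n) (Q ∘ proj₁)
maxChains↔ {d} n Q irrQ = ↔-trans
  (subtype-↔ chain (λ _ → ×-irrelevant Vec-≡-irrelevant (irrQ _))
             (λ _ → ×-irrelevant T-irrelevant (irrQ _)) into injective onto)
  (↔-sym Σ-assoc)
  where
  𝟏 : Vec ℕ d
  𝟏 = replicate d 1
  chain : List (Fin d) → List (Vec ℕ d)
  chain w = 𝟏 ∷ walk 𝟏 w
  Reaches : List (Fin d) → Set
  Reaches w = walkEnd 𝟏 w ≡ n × Q (chain w)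
  into : ∀ w → Reaches w → T (isMaxChain n (chain w)) × Q (chain w)
  into w (e , q) = Equivalence.from T-∧ (≡⇒==v 𝟏 𝟏 refl , walk-isPath 𝟏 n w e) , q
  injective : ∀ w w′ → Reaches w → Reaches w′ → chain w ≡ chain w′ → w ≡ w′
  injective w w′ _ _ e = walk-injective 𝟏 w w′ (∷-injectiveʳ e)
  onto : ∀ c → T (isMaxChain n c) × Q c → Σ (List (Fin d)) λ w → Reaches w × chain w ≡ c
  onto []       (() , _)
  onto (a ∷ cs) (mc , q) with Equivalence.to T-∧ mc
  ... | a=𝟏 , path with ==v⇒≡ a 𝟏 a=𝟏 | isPath⇒walk a n cs path
  ...   | refl | w , refl , e = w , (e , q) , refl

ones+pred≡ : ∀ (x : Vec ℕ d) → (∀ i → 1 ≤ lookup x i) → zipWith _+_ (replicate d 1) (map pred x) ≡ x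
ones+pred≡ {d} x 1≤x = Vec-ext λ i → begin
  lookup (zipWith _+_ (replicate d 1) (map pred x)) i   ≡⟨ lookup-zipWith _+_ i (replicate d 1) (map pred x) ⟩
  lookup (replicate d 1) i + lookup (map pred x) i      ≡⟨ cong₂ _+_ (lookup-replicate i 1) (lookup-map i pred x) ⟩
  suc (pred (lookup x i))                               ≡⟨ suc-pred (lookup x i) {{>-nonZero (1≤x i)}} ⟩
  lookup x i                                            ∎
  where open ≡-Reasoning

+∸≡ : ∀ (x n : Vec ℕ d) → (∀ i → lookup x i ≤ lookup n i) → zipWith _+_ x (zipWith _∸_ n x) ≡ n
+∸≡ x n x≤n = Vec-ext λ i → begin
  lookup (zipWith _+_ x (zipWith _∸_ n x)) i    ≡⟨ lookup-zipWith _+_ i x (zipWith _∸_ n x) ⟩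
  lookup x i + lookup (zipWith _∸_ n x) i       ≡⟨ cong (lookup x i +_) (lookup-zipWith _∸_ i n x) ⟩
  lookup x i + (lookup n i ∸ lookup x i)        ≡⟨ m+[n∸m]≡n (x≤n i) ⟩
  lookup n i                                    ∎
  where open ≡-Reasoning

multPerms↔walks : ∀ (x n : Vec ℕ d) k → (∀ i → 1 ≤ lookup x i × lookup x i ≤ lookup n i) →
  Σ (List (Fin d) × List (Fin d)) (λ (u , v) →
      (T (isMultPerm (map pred x) u) × T (isMultPerm (zipWith _∸_ n x) v)) × des u + des v ≡ k)
  ↔ Σ (List (Fin d) × List (Fin d)) (λ (u , v) →
      (walkEnd (replicate d 1) u ≡ x × walkEnd x v ≡ n) × des u + des v ≡ k)
multPerms↔walks {d} x n k hx = Σ-cong-irrelevant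
  (λ _ → ×-irrelevant (×-irrelevant T-irrelevant T-irrelevant) ≡-irrelevant)
  (λ _ → ×-irrelevant (×-irrelevant Vec-≡-irrelevant Vec-≡-irrelevant) ≡-irrelevant)
  (λ (u , v) ((mu , mv) , e) → (u-walk u .to mu , v-walk v .to mv) , e)
  (λ (u , v) ((eu , ev) , e) → (u-walk u .from eu , v-walk v .from ev) , e)
  where
  open Equivalence
  u-walk : ∀ u → T (isMultPerm (map pred x) u) ⇔ walkEnd (replicate d 1) u ≡ x
  u-walk u = subst (λ y → T (isMultPerm (map pred x) u) ⇔ walkEnd (replicate d 1) u ≡ y)
    (ones+pred≡ x (proj₁ ∘ hx)) (isMultPerm⇔walkEnd (map pred x) (replicate d 1) u)
  v-walk : ∀ v → T (isMultPerm (zipWith _∸_ n x) v) ⇔ walkEnd x v ≡ n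
  v-walk v = subst (λ y → T (isMultPerm (zipWith _∸_ n x) v) ⇔ walkEnd x v ≡ y)
    (+∸≡ x n (proj₂ ∘ hx)) (isMultPerm⇔walkEnd (zipWith _∸_ n x) x v)

lemma6p3 : ∀ {d : ℕ} (n x : Vec ℕ d) (k : ℕ) → 1 ≤ d
    → (∀ i → 1 ≤ lookup n i)
    → (∀ i → 1 ≤ lookup x i × lookup x i ≤ lookup n i)
    → Fin (coeffProd (map pred x) (zipWith _∸_ n x) k)
      ↔ Σ (MaxChain n) (λ F → T (memV x (proj₁ F) ∧ (rCountMinus x (proj₁ F) ≡ᵇ k)))
lemma6p3 {d} n x k _ _ hx =
  ↔-trans (Fin-coeffProd↔ (map pred x) (zipWith _∸_ n x) k)
  (↔-trans (multPerms↔walks x n k hx)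
  (↔-trans (walks-through↔ (replicate d 1) x n k)
           (maxChains↔ n (λ F → T (memV x F ∧ (rCountMinus x F ≡ᵇ k))) (λ _ → T-irrelevant))))
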